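{- Let $p$ be an odd prime and $\lambda$ a BG-partition. Then $a^*_\lambda$ is even if and only if $p\mid a^*_\lambda$.
   Context: A partition is a weakly decreasing sequence $\lambda=(\lambda_1\geq\lambda_2\geq\cdots)$ of nonnegative integers with finitely many nonzero terms; $\ell(\lambda)$ is the number of nonzero parts; $[\lambda]=\{(i,j):i\geq1,\ 1\leq j\leq\lambda_i\}$ (rows downward); $\lambda'$ is the conjugate; self-conjugate means $\lambda=\lambda'$. $k(\lambda)=\max\{i:\lambda_i\geq i\}$; $h^\lambda_{ij}=\lambda_i+\lambda'_j-i-j+1$. A BG-partition is a self-conjugate $\lambda$ with $p\nmid h^\lambda_{ii}$ for all $1\leq i\leq k(\lambda)$. $p$-rim: the rim is the set of $(i,j)\in[\lambda]$ with $(i+1,j+1)\notin[\lambda]$. Label rim nodes $1,2,\dots$ along the rim from $(1,\lambda_1)$ towards the bottom-left. The first $p$-segment is the rim nodes with labels $\leq p$. If the last node of a $p$-segment is in row $i<\ell(\lambda)$ and $l$ is the smallest label of a rim node in row $i+1$, the next $p$-segment is the rim nodes with labels $l,\dots,l+p-1$ (those which exist); continue until the last row. $\mathrm{Rim}_p(\lambda)$ is the union of the $p$-segments. For self-conjugate $\lambda$: $U_\lambda=\{(i,j)\in\mathrm{Rim}_p(\lambda):i\leq j\}$, $L_\lambda=\{(j,i):(i,j)\in U_\lambda\}$, $a^*_\lambda=\#(U_\lambda\cup L_\lambda)$. -}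

module Defs where

open import Data.Nat using (ℕ; zero; suc; _+_; _∸_; _≤_; _<ᵇ_; _≤ᵇ_; _≟_; _⊔_)
open import Data.Nat.Divisibility using (_∣_)
open import Data.Bool using (Bool; true; false; if_then_else_; not)
open import Data.List using (List; []; _∷_; length; map; filter; filterᵇ; concat; applyUpTo; take; drop; last; _++_; deduplicate; foldr)
open import Data.List.Relation.Unary.All using (All)
open import Data.List.Relation.Unary.Linked using (Linked)
open import Data.Maybe using (Maybe; just; nothing)
open import Data.Product using (_×_; _,_; proj₁; proj₂)
open import Data.Product.Properties using (≡-dec)
open import Relation.Nullary using (¬_)
open import Relation.Binary.PropositionalEquality using (_≡_)

-- A partition is represented by the list of its nonzero parts
-- (λ₁, λ₂, …, λ_ℓ), which must be positive and weakly decreasing.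
IsPartition : List ℕ → Set
IsPartition xs = All (λ x → 1 ≤ x) xs × Linked (λ a b → b ≤ a) xs

-- part xs i = λ_i  (1-indexed; 0 beyond the length, and 0 for i = 0)
part : List ℕ → ℕ → ℕ
part []       _             = 0
part (x ∷ xs) zero          = 0
part (x ∷ xs) (suc zero)    = x
part (x ∷ xs) (suc (suc i)) = part xs (suc i)

len : List ℕ → ℕ
len = length

conj : List ℕ → ℕ → ℕ
conj xs j = length (filterᵇ (λ x → j ≤ᵇ x) xs)

SelfConjugate : List ℕ → Set
SelfConjugate xs = ∀ j → 1 ≤ j → conj xs j ≡ part xs j

-- k(λ) = max { i ≥ 1 : λ_i ≥ i }  (0 if the set is empty);
-- any such i satisfies i ≤ λ_i, hence i ≤ ℓ(λ), so ranging over 1..ℓ suffices.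
kk : List ℕ → ℕ
kk xs = foldr _⊔_ 0 (applyUpTo (λ t → if suc t ≤ᵇ part xs (suc t) then suc t else 0) (len xs))

hook : List ℕ → ℕ → ℕ → ℕ
hook xs i j = (part xs i + conj xs j + 1) ∸ (i + j)

IsBG : ℕ → List ℕ → Set
IsBG p xs = SelfConjugate xs × (∀ i → 1 ≤ i → i ≤ kk xs → ¬ (p ∣ hook xs i i))

Node : Set
Node = ℕ × ℕ

-- all nodes of [λ], listed row by row (rows downward), and within a row from
-- right to left: (1,λ₁),(1,λ₁-1),…,(1,1),(2,λ₂),…
cellsRow : List ℕ → ℕ → List Node
cellsRow xs i = applyUpTo (λ t → (i , part xs i ∸ t)) (part xs i)

cells : List ℕ → List Node
cells xs = concat (applyUpTo (λ t → cellsRow xs (suc t)) (len xs))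

inDiagramᵇ : List ℕ → Node → Bool
inDiagramᵇ xs (i , j) = (1 ≤ᵇ i) Data.Bool.∧ ((1 ≤ᵇ j) Data.Bool.∧ (j ≤ᵇ part xs i))

-- the rim, in the order along the rim from (1,λ₁) towards the bottom-left;
-- the label of the n-th entry (0-based) is n+1.
rim : List ℕ → List Node
rim xs = filterᵇ (λ { (i , j) → not (inDiagramᵇ xs (suc i , suc j)) }) (cells xs)

-- 0-based index of the first element satisfying P (length if none)
firstIdx : {A : Set} → (A → Bool) → List A → ℕ
firstIdx P [] = 0
firstIdx P (x ∷ xs) = if P x then 0 else suc (firstIdx P xs)

firstLabelInRow : List ℕ → ℕ → ℕ
firstLabelInRow xs r = suc (firstIdx (λ nd → proj₁ nd Data.Nat.≡ᵇ r) (rim xs))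

segment : ℕ → List ℕ → ℕ → List Node
segment p xs l = take p (drop (l ∸ 1) (rim xs))

segments : ℕ → List ℕ → ℕ → ℕ → List Node
segments p xs zero    l = []
segments p xs (suc f) l with last (segment p xs l)
... | nothing      = []
... | just (i , j) = segment p xs l ++
        (if i <ᵇ len xs then segments p xs f (firstLabelInRow xs (suc i)) else [])

-- Rim_p(λ); the labels of successive segment starts strictly increase, so
-- (#rim) segments of fuel suffice.
rimP : ℕ → List ℕ → List Node
rimP p xs = segments p xs (length (rim xs)) 1

Uλ : ℕ → List ℕ → List Node
Uλ p xs = filterᵇ (λ { (i , j) → i ≤ᵇ j }) (rimP p xs)

Lλ : ℕ → List ℕ → List Node
Lλ p xs = map (λ { (i , j) → (j , i) }) (Uλ p xs)

-- a*_λ = #(U_λ ∪ L_λ)  (cardinality of the set union)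
aStar : ℕ → List ℕ → ℕ
aStar p xs = length (deduplicate (≡-dec _≟_ _≟_) (Uλ p xs ++ Lλ p xs))

module Submission where

-- Since λ is self-conjugate, n = λ₁ = ℓ(λ).  Read along the rim from (1 , λ₁),
-- the node at (0-based) position s has content j − i = n − 1 − s: the rim is a
-- "staircase".  So positions < n − 1 lie strictly above the diagonal, position
-- n − 1 on it, and later positions below it.  Every p-segment starts at the
-- first rim node (r , λ_r) of a row, and if it starts at a position s < n its
-- diagonal hook is h_rr = 2(n − s) − 1, which p does not divide by the BG
-- condition.  Hence U_λ consists of complete segments of p nodes strictly above
-- the diagonal, possibly followed by the n − s upper nodes of one segment
-- reaching the diagonal: either U_λ has no diagonal node and p ∣ #U_λ, or it has
-- one and p ∤ 2·#U_λ − 1.  As U_λ meets its mirror image L_λ exactly in its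
-- diagonal nodes, a*_λ = 2·#U_λ − #diag(U_λ), and the claim follows.

open import Defs
open import Data.Nat using (ℕ; zero; suc; _+_; _∸_; _≤_; _<_; _≤ᵇ_; _<ᵇ_; _≡ᵇ_; _≟_; _≤?_; _<?_; _⊔_; _⊓_; z≤n; s≤s)
open import Data.Nat.Properties
open import Data.Nat.Divisibility using (_∣_; divides; ∣-refl; _∣0; ∣1⇒≡1; ∣m∣n⇒∣m+n; ∣m+n∣m⇒∣n)
open import Data.Nat.Primality using (Prime)
open import Data.Nat.Tactic.RingSolver using (solve-∀)
open import Algebra.Properties.CommutativeSemigroup +-commutativeSemigroup using (interchange)
open import Data.Bool using (Bool; true; false; T; not; if_then_else_)
open import Data.Bool.Properties using (T?)
open import Data.Empty using (⊥-elim)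
open import Data.Unit using (⊤; tt)
open import Data.List using (List; []; _∷_; length; map; filter; filterᵇ; concat; applyUpTo; take; drop; last; _++_; deduplicate; foldr)
open import Data.List.Properties using (filter-accept; filter-reject; filter-all; filter-++; length-map; length-++; length-take; length-drop; length-applyUpTo; drop-drop; ++-identityʳ)
open import Data.List.Membership.Propositional using (_∈_; _∉_)
open import Data.List.Membership.Propositional.Properties using (∈-deduplicate⁺; ∈-deduplicate⁻; ∈-map⁺; ∈-map⁻; ∈-++⁺ʳ; ∈-++⁻)
open import Data.List.Relation.Unary.All as All using (All; []; _∷_)
open import Data.List.Relation.Unary.All.Properties using (¬Any⇒All¬; All¬⇒¬Any; applyUpTo⁺₁; applyUpTo⁺₂; take⁺; drop⁺; all-filter) renaming (++⁺ to All-++⁺)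
open import Data.List.Relation.Unary.Any using (here; there)
open import Data.List.Relation.Unary.AllPairs using (AllPairs; []; _∷_)
open import Data.List.Relation.Unary.Linked using (Linked; _∷_)
open import Data.List.Relation.Unary.Unique.Propositional using (Unique)
open import Data.List.Relation.Unary.Unique.Propositional.Properties using () renaming (map⁺ to Unique-map⁺)
import Data.List.Relation.Unary.Unique.DecPropositional.Properties as DecUnique
open import Data.List.Relation.Binary.Sublist.Propositional using (_⊆_; []; _∷_; _∷ʳ_; minimum; ⊆-refl; ⊆-trans)
open import Data.List.Relation.Binary.Sublist.Propositional.Properties using (All-resp-⊆; ++⁺; take-⊆; drop⁺-≥; filter-⊆)
open import Data.Maybe using (just; nothing)
open import Data.Product using (Σ; _×_; _,_; proj₁; proj₂; swap)
open import Data.Product.Properties using (≡-dec)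
open import Data.Sum using (_⊎_; inj₁; inj₂)
open import Function using (_∘_; _⇔_; mk⇔; Equivalence)
open import Relation.Nullary using (¬_; ¬?; yes; no)
open import Relation.Binary.Definitions using (DecidableEquality)
open import Relation.Binary.PropositionalEquality

T-not⁺ : ∀ {b} → ¬ T b → T (not b)
T-not⁺ {false} _  = _
T-not⁺ {true}  ¬t = ¬t _
T-not⁻ : ∀ {b} → T b → ¬ T (not b)
T-not⁻ {true} _ ()

filterᵇ-accept : {A : Set} (test : A → Bool) (x : A) (xs : List A) → T (test x) →
  filterᵇ test (x ∷ xs) ≡ x ∷ filterᵇ test xs
filterᵇ-accept test x xs = filter-accept (T? ∘ test) {x} {xs}

filterᵇ-reject : {A : Set} (test : A → Bool) (x : A) (xs : List A) → ¬ T (test x) →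
  filterᵇ test (x ∷ xs) ≡ filterᵇ test xs
filterᵇ-reject test x xs = filter-reject (T? ∘ test) {x} {xs}

filter-applyUpTo-prefix : {A : Set} (keep : A → Bool) (f : ℕ → A) (K m : ℕ) → m ≤ K →
  (∀ t → t < m → T (keep (f t))) → (∀ t → m ≤ t → t < K → ¬ T (keep (f t))) →
  filterᵇ keep (applyUpTo f K) ≡ applyUpTo f m
filter-applyUpTo-prefix keep f zero zero _ _ _ = refl
filter-applyUpTo-prefix keep f (suc K) zero _ _ out =
  trans (filterᵇ-reject keep (f 0) _ (out 0 z≤n (s≤s z≤n)))
        (filter-applyUpTo-prefix keep (f ∘ suc) K zero z≤n (λ _ ()) (λ t _ t<K → out (suc t) z≤n (s≤s t<K)))
filter-applyUpTo-prefix keep f (suc K) (suc m) (s≤s m≤K) inn out =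
  trans (filterᵇ-accept keep (f 0) _ (inn 0 (s≤s z≤n)))
        (cong (f 0 ∷_) (filter-applyUpTo-prefix keep (f ∘ suc) K m m≤K
          (λ t t<m → inn (suc t) (s≤s t<m)) (λ t m≤t t<K → out (suc t) (s≤s m≤t) (s≤s t<K))))

applyUpTo-head : {A : Set} (f : ℕ → A) (K : ℕ) → 1 ≤ K → Σ (List A) λ tl → applyUpTo f K ≡ f 0 ∷ tl
applyUpTo-head f (suc K) _ = applyUpTo (f ∘ suc) K , refl

take++drop-length : {A : Set} (k : ℕ) (ys : List A) → take k ys ++ drop (length (take k ys)) ys ≡ ys
take++drop-length zero    ys       = refl
take++drop-length (suc k) []       = refl
take++drop-length (suc k) (y ∷ ys) = cong (y ∷_) (take++drop-length k ys)

drop-nonempty : {A : Set} {k : ℕ} {x : A} {tl : List A} (ys : List A) → drop k ys ≡ x ∷ tl → k < length ys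
drop-nonempty {k = k} ys e = m∸n≢0⇒n<m (λ empty → 0≢1+n (trans (sym empty) (trans (sym (length-drop k ys)) (cong length e))))

last≡nothing⇒[] : {A : Set} (ys : List A) → last ys ≡ nothing → ys ≡ []
last≡nothing⇒[] []           _ = refl
last≡nothing⇒[] (y ∷ [])     ()
last≡nothing⇒[] (y ∷ z ∷ zs) e with () ← last≡nothing⇒[] (z ∷ zs) e

All-last : {A : Set} {P : A → Set} {x : A} (ys : List A) → All P ys → last ys ≡ just x → P x
All-last (y ∷ [])     (py ∷ _)   refl = py
All-last (y ∷ z ∷ zs) (_ ∷ pzs) e    = All-last (z ∷ zs) pzs e

firstIdx-skip : {A : Set} (test : A → Bool) (ys zs : List A) → All (λ y → ¬ T (test y)) ys →
  drop (firstIdx test (ys ++ zs)) (ys ++ zs) ≡ drop (firstIdx test zs) zs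
firstIdx-skip test []       zs []         = refl
firstIdx-skip test (y ∷ ys) zs (¬t ∷ ¬ts) with test y
... | true  = ⊥-elim (¬t _)
... | false = firstIdx-skip test ys zs ¬ts

firstIdx-here : {A : Set} (test : A → Bool) (y : A) (ys : List A) → T (test y) → firstIdx test (y ∷ ys) ≡ 0
firstIdx-here test y ys t with test y
... | true  = refl
... | false = ⊥-elim t

AllPairs-resp-⊆ : {A : Set} {R : A → A → Set} {xs ys : List A} → xs ⊆ ys → AllPairs R ys → AllPairs R xs
AllPairs-resp-⊆ []         []         = []
AllPairs-resp-⊆ (y ∷ʳ τ)   (_ ∷ rys)  = AllPairs-resp-⊆ τ rys
AllPairs-resp-⊆ (refl ∷ τ) (ry ∷ rys) = All-resp-⊆ τ ry ∷ AllPairs-resp-⊆ τ rys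

≤-foldr-⊔ : ∀ L (F : ℕ → ℕ) t → t < L → F t ≤ foldr _⊔_ 0 (applyUpTo F L)
≤-foldr-⊔ (suc L) F zero    _         = m≤m⊔n (F 0) _
≤-foldr-⊔ (suc L) F (suc t) (s≤s t<L) = ≤-trans (≤-foldr-⊔ L (F ∘ suc) t t<L) (m≤n⊔m (F 0) _)

module Distinct {A : Set} (_≟_ : DecidableEquality A) where

  dedup : List A → List A
  dedup = deduplicate _≟_

  -- deduplicate keeps the head and deletes its later copies by this filter.
  without : A → List A → List A
  without x = filter (¬? ∘ (x ≟_))

  without-∉ : ∀ {x} ys → x ∉ ys → without x ys ≡ ys
  without-∉ ys x∉ys = filter-all (¬? ∘ (_ ≟_)) (¬Any⇒All¬ ys x∉ys)

  length-without-∈ : ∀ {x} ys → Unique ys → x ∈ ys → suc (length (without x ys)) ≡ length ys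
  length-without-∈ {x} (y ∷ ys) (y∉ys ∷ u) x∈ with x ≟ y
  ... | yes refl = cong (suc ∘ length) (without-∉ ys (All¬⇒¬Any y∉ys))
  ... | no x≢y with x∈
  ...   | here x≡y   = ⊥-elim (x≢y x≡y)
  ...   | there x∈ys = cong suc (length-without-∈ ys u x∈ys)

  length-dedup-∉ : ∀ {x} xs → x ∉ xs → length (dedup (x ∷ xs)) ≡ suc (length (dedup xs))
  length-dedup-∉ xs x∉xs = cong (suc ∘ length) (without-∉ (dedup xs) (x∉xs ∘ ∈-deduplicate⁻ _≟_ xs))

  length-dedup-∈ : ∀ {x} xs → x ∈ xs → length (dedup (x ∷ xs)) ≡ length (dedup xs)
  length-dedup-∈ xs x∈xs = length-without-∈ (dedup xs) (DecUnique.deduplicate-! _≟_ xs) (∈-deduplicate⁺ _≟_ x∈xs)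

  length-dedup-unique : ∀ xs → Unique xs → length (dedup xs) ≡ length xs
  length-dedup-unique []       _           = refl
  length-dedup-unique (x ∷ xs) (x∉xs ∷ u) =
    trans (length-dedup-∉ xs (All¬⇒¬Any x∉xs)) (cong suc (length-dedup-unique xs u))

  length-dedup-++ : (shared : A → Bool) (U L : List A) → Unique U →
    (∀ {u} → u ∈ U → (u ∈ L ⇔ T (shared u))) →
    length (dedup (U ++ L)) + length (filterᵇ shared U) ≡ length U + length (dedup L)
  length-dedup-++ shared []      L _ _ = +-identityʳ _
  length-dedup-++ shared (u ∷ U) L (u∉U ∷ uniq) in-L⇔shared with shared u in u-shared
  ... | true = begin
        length (dedup (u ∷ U ++ L)) + suc (length (filterᵇ shared U)) ≡⟨ cong₂ _+_ u-absorbed refl ⟩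
        length (dedup (U ++ L)) + suc (length (filterᵇ shared U))     ≡⟨ +-suc _ _ ⟩
        suc (length (dedup (U ++ L)) + length (filterᵇ shared U))     ≡⟨ cong suc rest ⟩
        suc (length U + length (dedup L))                              ∎
      where
        open ≡-Reasoning
        rest = length-dedup-++ shared U L uniq (in-L⇔shared ∘ there)
        u-absorbed = length-dedup-∈ (U ++ L) (∈-++⁺ʳ U (Equivalence.from (in-L⇔shared (here refl)) (subst T (sym u-shared) _)))
  ... | false = trans (cong₂ _+_ (length-dedup-∉ (U ++ L) u∉U++L) refl) (cong suc rest)
      where
        rest = length-dedup-++ shared U L uniq (in-L⇔shared ∘ there)
        u∉U++L : u ∉ U ++ L
        u∉U++L u∈ with ∈-++⁻ U u∈
        ... | inj₁ u∈U = All¬⇒¬Any u∉U u∈U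
        ... | inj₂ u∈L = subst T u-shared (Equivalence.to (in-L⇔shared (here refl)) u∈L)

isUpper : Node → Bool
isUpper (i , j) = i ≤ᵇ j
isDiagonal : Node → Bool
isDiagonal (i , j) = i ≡ᵇ j

-- A duplicate-free list U of nodes weakly above the diagonal meets its mirror
-- image exactly in its diagonal nodes, so  #(U ∪ Uᵗ) + #diag(U) = 2·#U.
mirror-count : (U : List Node) → Unique U → All (T ∘ isUpper) U →
  length (deduplicate (≡-dec _≟_ _≟_) (U ++ map swap U)) + length (filterᵇ isDiagonal U) ≡ length U + length U
mirror-count U uniq upper = begin
  length (dedup (U ++ map swap U)) + length (filterᵇ isDiagonal U)
    ≡⟨ length-dedup-++ isDiagonal U (map swap U) uniq mirrored⇔diagonal ⟩
  length U + length (dedup (map swap U))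
    ≡⟨ cong (length U +_) (length-dedup-unique (map swap U) (Unique-map⁺ (cong swap) uniq)) ⟩
  length U + length (map swap U)
    ≡⟨ cong (length U +_) (length-map swap U) ⟩
  length U + length U ∎
  where
    open ≡-Reasoning
    open Distinct (≡-dec _≟_ _≟_)
    mirrored⇔diagonal : ∀ {u} → u ∈ U → (u ∈ map swap U ⇔ T (isDiagonal u))
    mirrored⇔diagonal {a , b} u∈U = mk⇔ mirrored⇒diagonal diagonal⇒mirrored
      where
        mirrored⇒diagonal : (a , b) ∈ map swap U → T (a ≡ᵇ b)
        mirrored⇒diagonal m with ∈-map⁻ swap m
        ... | _ , v∈U , refl =
          ≡⇒≡ᵇ a b (≤-antisym (≤ᵇ⇒≤ a b (All.lookup upper u∈U)) (≤ᵇ⇒≤ b a (All.lookup upper v∈U)))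
        diagonal⇒mirrored : T (a ≡ᵇ b) → (a , b) ∈ map swap U
        diagonal⇒mirrored t with ≡ᵇ⇒≡ a b t
        ... | refl = ∈-map⁺ swap u∈U

<∸-swap : ∀ m q t → t < m ∸ q → q < m ∸ t
<∸-swap m q t t<m∸q = m+n≤o⇒m≤o∸n (suc q) (subst (_≤ m) (cong suc (+-comm t q)) (m≤o∸n⇒m+n≤o (suc t) q≤m t<m∸q))
  where q≤m = <⇒≤ (m∸n≢0⇒n<m (m<n⇒n≢0 t<m∸q))

column-≥ : ∀ m q t → t < m ∸ (q ∸ 1) → q ≤ m ∸ t
column-≥ m zero    t _  = z≤n
column-≥ m (suc q) t lt = <∸-swap m q t lt

column-< : ∀ m q t → m ∸ (q ∸ 1) ≤ t → t < m → m ∸ t < q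
column-< m zero    t le lt = ⊥-elim (<⇒≱ lt le)
column-< m (suc q) t le lt = s≤s (≮⇒≥ (λ q<m∸t → <⇒≱ (<∸-swap m t q q<m∸t) le))

column-count : ∀ m q → 1 ≤ q → q ≤ m → m ∸ (q ∸ 1) + q ≡ suc m
column-count m (suc q) _ q<m = trans (+-suc (m ∸ q) q) (cong suc (m∸n+n≡m (<⇒≤ q<m)))

columns-nonempty : ∀ m q → 1 ≤ m → q ≤ m → 1 ≤ m ∸ (q ∸ 1)
columns-nonempty m zero    1≤m _   = 1≤m
columns-nonempty m (suc q) _   q<m = m<n⇒0<n∸m q<m

hook-arith : ∀ r d → r + d + (r + d) + 1 ≡ (r + r) + suc (d + d)
hook-arith = solve-∀

shift-arith : ∀ s r d → suc (s + (r + d)) ≡ s + suc d + r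
shift-arith = solve-∀

double-shift : ∀ p w → 1 ≤ w → p + w + (p + w) ∸ 1 ≡ (p + p) + (w + w ∸ 1)
double-shift p w 1≤w = trans (cong (_∸ 1) (interchange p w p w)) (+-∸-assoc (p + p) (≤-trans 1≤w (m≤m+n w w)))

double-even : ∀ v → 2 ∣ v + v
double-even v = divides v (trans (cong (v +_) (sym (+-identityʳ v))) (*-comm 2 v))

part-step : ∀ ys → Linked (λ a b → b ≤ a) ys → ∀ i → part ys (suc (suc i)) ≤ part ys (suc i)
part-step []           _         i       = z≤n
part-step (y ∷ [])     _         zero    = z≤n
part-step (y ∷ [])     _         (suc i) = z≤n
part-step (y ∷ z ∷ zs) (z≤y ∷ _) zero    = z≤y
part-step (y ∷ z ∷ zs) (_ ∷ lnk) (suc i) = part-step (z ∷ zs) lnk i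

part-≤-first : ∀ ys → Linked (λ a b → b ≤ a) ys → ∀ i → part ys i ≤ part ys 1
part-≤-first []       _   i             = z≤n
part-≤-first (y ∷ ys) _   zero          = z≤n
part-≤-first (y ∷ ys) _   (suc zero)    = ≤-refl
part-≤-first (y ∷ ys) lnk (suc (suc i)) = ≤-trans (part-step (y ∷ ys) lnk i) (part-≤-first (y ∷ ys) lnk (suc i))

part-positive : ∀ ys → All (λ y → 1 ≤ y) ys → ∀ i → 1 ≤ i → i ≤ length ys → 1 ≤ part ys i
part-positive (y ∷ ys) (1≤y ∷ _)   (suc zero)    _ _         = 1≤y
part-positive (y ∷ ys) (_ ∷ pos) (suc (suc i)) _ (s≤s i<ℓ) = part-positive ys pos (suc i) (s≤s z≤n) i<ℓ

conj-1 : ∀ ys → All (λ y → 1 ≤ y) ys → conj ys 1 ≡ length ys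
conj-1 []       []          = refl
conj-1 (y ∷ ys) (1≤y ∷ pos) with 1 ≤ᵇ y | ≤⇒≤ᵇ 1≤y
... | true | _ = cong suc (conj-1 ys pos)

≤-kk : ∀ xs r → 1 ≤ r → r ≤ length xs → r ≤ part xs r → r ≤ kk xs
≤-kk xs (suc t) _ r≤ℓ r≤λr = ≤-trans (≤-reflexive (sym entry≡r)) (≤-foldr-⊔ (length xs) _ t r≤ℓ)
  where
    entry≡r : (if suc t ≤ᵇ part xs (suc t) then suc t else 0) ≡ suc t
    entry≡r with suc t ≤ᵇ part xs (suc t) | ≤⇒≤ᵇ r≤λr
    ... | true | _ = refl

-- Nodes listed along a "staircase" of width n: the entry at position s has
-- content j − i = n − 1 − s.  The rim of a partition with λ₁ = n is such a
-- staircase, read from position 0.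
module Stairs (n : ℕ) where

  At : ℕ → Node → Set
  At s (i , j) = suc (s + j) ≡ n + i

  Staircase : ℕ → List Node → Set
  Staircase s []       = ⊤
  Staircase s (y ∷ ys) = At s y × Staircase (suc s) ys

  at-below : ∀ {s i j} → At s (i , j) → n ≤ s → j < i
  at-below {s} {i} {j} at n≤s =
    +-cancelˡ-≤ s (suc j) i (≤-trans (≤-reflexive (trans (+-suc s j) at)) (+-monoˡ-≤ i n≤s))

  at-above : ∀ {s i j} → At s (i , j) → suc s < n → i < j
  at-above {s} {i} {j} at s+1<n =
    +-cancelˡ-≤ (suc s) (suc i) j (≤-trans (≤-reflexive (+-suc (suc s) i)) (≤-trans (+-monoˡ-≤ i s+1<n) (≤-reflexive (sym at))))

  at-diagonal : ∀ {s i j} → At s (i , j) → suc s ≡ n → i ≡ j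
  at-diagonal {s} {i} {j} at s+1≡n = +-cancelˡ-≡ (suc s) i j (trans (cong (_+ i) s+1≡n) (sym at))

  at-injective : ∀ {s t} x → At s x → At t x → s ≡ t
  at-injective {s} {t} (i , j) at at′ = +-cancelʳ-≡ j s t (suc-injective (trans at (sym at′)))

  staircase-++ : ∀ s xs ys → Staircase s xs → Staircase (s + length xs) ys → Staircase s (xs ++ ys)
  staircase-++ s []       ys _         st′ = subst (λ t → Staircase t ys) (+-identityʳ s) st′
  staircase-++ s (x ∷ xs) ys (at , st) st′ =
    at , staircase-++ (suc s) xs ys st (subst (λ t → Staircase t ys) (+-suc s (length xs)) st′)

  staircase-drop : ∀ k s ys → Staircase s ys → Staircase (s + k) (drop k ys)
  staircase-drop zero    s ys       st       = subst (λ t → Staircase t ys) (sym (+-identityʳ s)) st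
  staircase-drop (suc k) s []       _        = tt
  staircase-drop (suc k) s (y ∷ ys) (_ , st) =
    subst (λ t → Staircase t (drop k ys)) (sym (+-suc s k)) (staircase-drop k (suc s) ys st)

  staircase-take : ∀ k s ys → Staircase s ys → Staircase s (take k ys)
  staircase-take zero    s ys       _         = tt
  staircase-take (suc k) s []       _         = tt
  staircase-take (suc k) s (y ∷ ys) (at , st) = at , staircase-take k (suc s) ys st

  staircase-at : ∀ {s x tl} ys → Staircase 0 ys → drop s ys ≡ x ∷ tl → At s x
  staircase-at {s} ys st e = proj₁ (subst (Staircase s) e (staircase-drop s 0 ys st))

  staircase-last : ∀ s ys {i j} → Staircase s ys → last ys ≡ just (i , j) → s + length ys + j ≡ n + i
  staircase-last s (y ∷ [])     {j = j} (at , _) refl = trans (cong (_+ j) (+-comm s 1)) at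
  staircase-last s (y ∷ z ∷ zs) {j = j} (_ , st) e  =
    trans (cong (_+ j) (+-suc s (length (z ∷ zs)))) (staircase-last (suc s) (z ∷ zs) st e)

  below-diagonal : ∀ s ys → Staircase s ys → n ≤ s → filterᵇ isUpper ys ≡ []
  below-diagonal s []             _         _   = refl
  below-diagonal s ((i , j) ∷ ys) (at , st) n≤s =
    trans (filterᵇ-reject isUpper (i , j) ys (<⇒≱ (at-below at n≤s) ∘ ≤ᵇ⇒≤ i j))
          (below-diagonal (suc s) ys st (m≤n⇒m≤1+n n≤s))

  above-diagonal : ∀ s ys → Staircase s ys → s + length ys < n →
    filterᵇ isUpper ys ≡ ys × filterᵇ isDiagonal ys ≡ []
  above-diagonal s []             _         _     = refl , refl
  above-diagonal s ((i , j) ∷ ys) (at , st) end<n =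
      trans (filterᵇ-accept isUpper (i , j) ys (≤⇒≤ᵇ (<⇒≤ i<j))) (cong ((i , j) ∷_) (proj₁ rest))
    , trans (filterᵇ-reject isDiagonal (i , j) ys (<⇒≢ i<j ∘ ≡ᵇ⇒≡ i j)) (proj₂ rest)
    where
      end<n′ : suc s + length ys < n
      end<n′ = subst (_< n) (+-suc s (length ys)) end<n
      i<j = at-above at (≤-<-trans (m≤m+n (suc s) (length ys)) end<n′)
      rest = above-diagonal (suc s) ys st end<n′

  crosses-diagonal : ∀ s ys → Staircase s ys → s < n → n ≤ s + length ys →
    length (filterᵇ isUpper ys) ≡ n ∸ s × length (filterᵇ isDiagonal (filterᵇ isUpper ys)) ≡ 1
  crosses-diagonal s [] _ s<n n≤s+0 = ⊥-elim (<⇒≱ s<n (subst (n ≤_) (+-identityʳ s) n≤s+0))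
  crosses-diagonal s ((i , j) ∷ ys) (at , st) s<n n≤end with suc s ≟ n
  ... | yes s+1≡n =
      trans (cong length upper) (sym (trans (cong (_∸ s) (sym s+1≡n)) (m+n∸n≡m 1 s)))
    , trans (cong (length ∘ filterᵇ isDiagonal) upper)
            (cong length (filterᵇ-accept isDiagonal (i , j) [] (≡⇒≡ᵇ i j i≡j)))
    where
      i≡j = at-diagonal at s+1≡n
      upper : filterᵇ isUpper ((i , j) ∷ ys) ≡ (i , j) ∷ []
      upper = trans (filterᵇ-accept isUpper (i , j) ys (≤⇒≤ᵇ (≤-reflexive i≡j)))
                    (cong ((i , j) ∷_) (below-diagonal (suc s) ys st (≤-reflexive (sym s+1≡n))))
  ... | no s+1≢n =
      trans (cong length upper) (trans (cong suc (proj₁ rest)) (sym (+-∸-assoc 1 s<n)))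
    , trans (cong (length ∘ filterᵇ isDiagonal) upper)
            (trans (cong length (filterᵇ-reject isDiagonal (i , j) (filterᵇ isUpper ys) (<⇒≢ i<j ∘ ≡ᵇ⇒≡ i j))) (proj₂ rest))
    where
      s+1<n = ≤∧≢⇒< s<n s+1≢n
      i<j = at-above at s+1<n
      rest = crosses-diagonal (suc s) ys st s+1<n (subst (n ≤_) (+-suc s (length ys)) n≤end)
      upper : filterᵇ isUpper ((i , j) ∷ ys) ≡ (i , j) ∷ filterᵇ isUpper ys
      upper = filterᵇ-accept isUpper (i , j) ys (≤⇒≤ᵇ (<⇒≤ i<j))

  -- Distinct positions carry distinct nodes, so a staircase has no repetitions.
  staircase-avoids : ∀ {s t} x ys → At s x → s < t → Staircase t ys → All (x ≢_) ys
  staircase-avoids x []       _  _   _          = []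
  staircase-avoids x (y ∷ ys) at s<t (at′ , st) =
    (λ { refl → <⇒≢ s<t (at-injective x at at′) }) ∷ staircase-avoids x ys at (m<n⇒m<1+n s<t) st

  staircase-unique : ∀ s ys → Staircase s ys → Unique ys
  staircase-unique s []       _         = []
  staircase-unique s (y ∷ ys) (at , st) = staircase-avoids y ys at (n<1+n s) st ∷ staircase-unique (suc s) ys st

module Rim (xs : List ℕ) (isP : IsPartition xs) where

  row : ℕ → ℕ
  row = part xs

  n ℓ : ℕ
  n = row 1
  ℓ = length xs

  open Stairs n public

  row-step : ∀ i → row (suc (suc i)) ≤ row (suc i)
  row-step = part-step xs (proj₂ isP)

  row-positive : ∀ i → 1 ≤ i → i ≤ ℓ → 1 ≤ row i
  row-positive = part-positive xs (proj₁ isP)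

  onRim : Node → Bool
  onRim (i , j) = not (inDiagramᵇ xs (suc i , suc j))

  -- Row a contributes its columns λ_a, λ_a − 1, …, max(λ_{a+1}, 1) to the rim.
  rimRowLength : ℕ → ℕ
  rimRowLength a = row a ∸ (row (suc a) ∸ 1)

  rimRow : ℕ → List Node
  rimRow a = applyUpTo (λ t → (a , row a ∸ t)) (rimRowLength a)

  rimRow-filter : ∀ a → filterᵇ onRim (cellsRow xs a) ≡ rimRow a
  rimRow-filter a = filter-applyUpTo-prefix onRim (λ t → (a , row a ∸ t)) (row a) (rimRowLength a) (m∸n≤m (row a) (row (suc a) ∸ 1))
    (λ t t<len → T-not⁺ (λ below → <⇒≱ (<ᵇ⇒< _ _ below) (column-≥ (row a) (row (suc a)) t t<len)))
    (λ t len≤t t<row → T-not⁻ (<⇒<ᵇ (column-< (row a) (row (suc a)) t len≤t t<row)))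

  rimRows : ℕ → ℕ → List Node
  rimRows a zero    = []
  rimRows a (suc k) = rimRow a ++ rimRows (suc a) k

  rim-rows : rim xs ≡ rimRows 1 ℓ
  rim-rows = filter-rows 1 ℓ (λ t → cellsRow xs (suc t)) (λ t → refl)
    where
      filter-rows : ∀ a k (g : ℕ → List Node) → (∀ t → g t ≡ cellsRow xs (a + t)) →
        filterᵇ onRim (concat (applyUpTo g k)) ≡ rimRows a k
      filter-rows a zero    g g≡ = refl
      filter-rows a (suc k) g g≡ = trans (filter-++ (T? ∘ onRim) (g 0) _) (cong₂ _++_ first rest)
        where
          first = trans (cong (filterᵇ onRim) (trans (g≡ 0) (cong (cellsRow xs) (+-identityʳ a)))) (rimRow-filter a)
          rest = filter-rows (suc a) k (g ∘ suc) (λ t → trans (g≡ (suc t)) (cong (cellsRow xs) (+-suc a t)))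

  row-staircase : ∀ a K m s → K ≤ m → At s (a , m) → Staircase s (applyUpTo (λ t → (a , m ∸ t)) K)
  row-staircase a zero    m       s _         _  = tt
  row-staircase a (suc K) (suc m) s (s≤s K≤m) at =
    at , row-staircase a K m (suc s) K≤m (trans (cong suc (sym (+-suc s m))) at)

  next-row-at : ∀ a s → 1 ≤ row (suc a) → row (suc a) ≤ row a → At s (a , row a) →
    At (s + rimRowLength a) (suc a , row (suc a))
  next-row-at a s pos step at = begin
    suc (s + rimRowLength a + row (suc a))   ≡⟨ cong suc (+-assoc s _ _) ⟩
    suc (s + (rimRowLength a + row (suc a))) ≡⟨ cong (suc ∘ (s +_)) (column-count (row a) (row (suc a)) pos step) ⟩
    suc (s + suc (row a))                    ≡⟨ cong suc (+-suc s (row a)) ⟩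
    suc (suc (s + row a))                    ≡⟨ cong suc at ⟩
    suc (n + a)                              ≡⟨ sym (+-suc n a) ⟩
    n + suc a                                ∎
    where open ≡-Reasoning

  first-row-exists : ∀ a k → a + suc k ≤ ℓ → suc a ≤ ℓ
  first-row-exists a k bound = ≤-trans (s≤s (m≤m+n a k)) (≤-trans (≤-reflexive (sym (+-suc a k))) bound)

  later-rows-exist : ∀ a k → a + suc k ≤ ℓ → suc a + k ≤ ℓ
  later-rows-exist a k bound = ≤-trans (≤-reflexive (sym (+-suc a k))) bound

  rimRows-staircase : ∀ a k s → a + k ≤ ℓ → At s (suc a , row (suc a)) → Staircase s (rimRows (suc a) k)
  rimRows-staircase a zero    s _     _  = tt
  rimRows-staircase a (suc k) s bound at =
    staircase-++ s (rimRow (suc a)) (rimRows (suc (suc a)) k)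
      (row-staircase (suc a) (rimRowLength (suc a)) (row (suc a)) s (m∸n≤m (row (suc a)) (row (suc (suc a)) ∸ 1)) at)
      (subst (λ t → Staircase t (rimRows (suc (suc a)) k)) (cong (s +_) (sym (length-applyUpTo _ (rimRowLength (suc a)))))
        (rest k (later-rows-exist a k bound)))
    where
      rest : ∀ k → suc a + k ≤ ℓ → Staircase (s + rimRowLength (suc a)) (rimRows (suc (suc a)) k)
      rest zero     _      = tt
      rest (suc k′) bound′ = rimRows-staircase (suc a) (suc k′) _ bound′
        (next-row-at (suc a) s (row-positive (suc (suc a)) (s≤s z≤n) (first-row-exists (suc a) k′ bound′)) (row-step a) at)

  RimColumn : Node → Set
  RimColumn (i , j) = row (suc i) ≤ j

  rimRows-columns : ∀ a k → All RimColumn (rimRows a k)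
  rimRows-columns a zero    = []
  rimRows-columns a (suc k) =
    All-++⁺ (applyUpTo⁺₁ _ (rimRowLength a) (λ {t} → column-≥ (row a) (row (suc a)) t)) (rimRows-columns (suc a) k)

  inRow : ℕ → Node → Bool
  inRow r (i , j) = i ≡ᵇ r

  rimRows-rowStart : ∀ a k r → a + k ≤ ℓ → suc a ≤ r → r ≤ a + k →
    Σ (List Node) λ tl → drop (firstIdx (inRow r) (rimRows (suc a) k)) (rimRows (suc a) k) ≡ (r , row r) ∷ tl
  rimRows-rowStart a zero    r _     a<r r≤a+0 = ⊥-elim (<⇒≱ a<r (subst (r ≤_) (+-identityʳ a) r≤a+0))
  rimRows-rowStart a (suc k) r bound a<r r≤end with r ≟ suc a
  ... | yes refl = subst (λ L → Σ (List Node) λ tl → drop (firstIdx (inRow r) (L ++ rest)) (L ++ rest) ≡ first ∷ tl)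
                     (sym (proj₂ head)) (proj₁ head ++ rest , cong (λ i → drop i (first ∷ proj₁ head ++ rest)) found)
    where
      rest = rimRows (suc r) k
      first = (r , row r)
      head = applyUpTo-head (λ t → (r , row r ∸ t)) (rimRowLength r)
               (columns-nonempty (row r) _ (row-positive r (s≤s z≤n) (first-row-exists a k bound)) (row-step a))
      found = firstIdx-here (inRow r) first (proj₁ head ++ rest) (≡⇒≡ᵇ r r refl)
  ... | no r≢a+1 = proj₁ later , trans (firstIdx-skip (inRow r) (rimRow (suc a)) _ others) (proj₂ later)
    where
      others = applyUpTo⁺₂ _ (rimRowLength (suc a)) (λ t → r≢a+1 ∘ sym ∘ ≡ᵇ⇒≡ (suc a) r)
      later = rimRows-rowStart (suc a) k r (later-rows-exist a k bound) (≤∧≢⇒< a<r (r≢a+1 ∘ sym)) (subst (r ≤_) (+-suc a k) r≤end)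

  -- The rim itself, its length, and the 0-based position of the first rim node of row r
  -- (one less than the label `firstLabelInRow` used by the p-segments).
  R : List Node
  R = rim xs

  N : ℕ
  N = length R

  pos : ℕ → ℕ
  pos r = firstIdx (inRow r) R

  rim-staircase : Staircase 0 R
  rim-staircase = subst (Staircase 0) (sym rim-rows) (rimRows-staircase 0 ℓ 0 ≤-refl (sym (+-comm n 1)))

  rim-columns : All RimColumn R
  rim-columns = subst (All RimColumn) (sym rim-rows) (rimRows-columns 1 ℓ)

  rowStart : ∀ r → 1 ≤ r → r ≤ ℓ → Σ (List Node) λ tl → drop (pos r) R ≡ (r , row r) ∷ tl
  rowStart r 1≤r r≤ℓ = subst (λ Q → Σ (List Node) λ tl → drop (firstIdx (inRow r) Q) Q ≡ (r , row r) ∷ tl)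
                         (sym rim-rows) (rimRows-rowStart 0 ℓ r ≤-refl 1≤r r≤ℓ)

  rowStart-at : ∀ r → 1 ≤ r → r ≤ ℓ → At (pos r) (r , row r)
  rowStart-at r 1≤r r≤ℓ = staircase-at R rim-staircase (proj₂ (rowStart r 1≤r r≤ℓ))

CountsWell : ℕ → ℕ → ℕ → Set
CountsWell p d m = (d ≡ 0 × p ∣ m) ⊎ (d ≡ 1 × ¬ p ∣ (m + m ∸ 1))

-- Adding p to the size preserves the invariant (in the second case m ≠ 0,
-- as p divides 2·0 − 1 = 0).
countsWell-+p : ∀ p d m → CountsWell p d m → CountsWell p d (p + m)
countsWell-+p p d m       (inj₁ (none , p∣m)) = inj₁ (none , ∣m∣n⇒∣m+n ∣-refl p∣m)
countsWell-+p p d zero    (inj₂ (_ , p∤))     = ⊥-elim (p∤ (p ∣0))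
countsWell-+p p d (suc m) (inj₂ (one , p∤))   = inj₂ (one , λ p∣ →
  p∤ (∣m+n∣m⇒∣n (subst (p ∣_) (double-shift p (suc m) (s≤s z≤n)) p∣) (∣m∣n⇒∣m+n ∣-refl ∣-refl)))

-- If a + d = 2m and the invariant holds, then a is even iff p ∣ a: either
-- a = 2m with p ∣ m, or a = 2m − 1 is odd and not divisible by p.
even⇔divisible : ∀ p a d m → CountsWell p d m → a + d ≡ m + m → (2 ∣ a → p ∣ a) × (p ∣ a → 2 ∣ a)
even⇔divisible p a d m (inj₁ (refl , p∣m)) a+0≡ =
  (λ _ → subst (p ∣_) (sym a≡) (∣m∣n⇒∣m+n p∣m p∣m)) , (λ _ → subst (2 ∣_) (sym a≡) (double-even m))
  where
    a≡ : a ≡ m + m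
    a≡ = trans (sym (+-identityʳ a)) a+0≡
even⇔divisible p a d m (inj₂ (refl , p∤)) a+1≡ =
  (λ 2∣a → ⊥-elim (odd 2∣a)) , (λ p∣a → ⊥-elim (p∤ (subst (p ∣_) a≡ p∣a)))
  where
    a≡ : a ≡ m + m ∸ 1
    a≡ = trans (sym (m+n∸n≡m a 1)) (cong (_∸ 1) a+1≡)
    odd : ¬ 2 ∣ a
    odd 2∣a with () ← ∣1⇒≡1 (∣m+n∣m⇒∣n (subst (2 ∣_) (sym a+1≡) (double-even m)) 2∣a)

UpperCount : ℕ → List Node → Set
UpperCount p V = CountsWell p (length (filterᵇ isDiagonal V)) (length V)

upperCount-[] : ∀ p → UpperCount p []
upperCount-[] p = inj₁ (refl , p ∣0)

upperCount-++ : ∀ p S W → length S ≡ p → filterᵇ isDiagonal S ≡ [] → UpperCount p W → UpperCount p (S ++ W)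
upperCount-++ p S W |S|≡p S-off count = subst₂ (CountsWell p) (sym diag≡) (sym size≡) (countsWell-+p p _ _ count)
  where
    diag≡ : length (filterᵇ isDiagonal (S ++ W)) ≡ length (filterᵇ isDiagonal W)
    diag≡ = cong length (trans (filter-++ (T? ∘ isDiagonal) S W) (cong (_++ _) S-off))
    size≡ : length (S ++ W) ≡ p + length W
    size≡ = trans (length-++ S) (cong (_+ length W) |S|≡p)

module Segments (p : ℕ) (xs : List ℕ) (isP : IsPartition xs) (sc : SelfConjugate xs)
                (bg : ∀ i → 1 ≤ i → i ≤ kk xs → ¬ p ∣ hook xs i i) where

  open Rim xs isP

  -- For a self-conjugate partition λ₁ = λ'₁ = ℓ(λ).
  n≡ℓ : n ≡ ℓ
  n≡ℓ = trans (sym (sc 1 (s≤s z≤n))) (conj-1 xs (proj₁ isP))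

  -- The rim has at least n nodes: row ℓ starts at position ≥ ℓ − 1.
  n≤N : n ≤ N
  n≤N with 1 ≤? ℓ
  ... | no ℓ≱1 = subst (_≤ N) (sym n≡ℓ) (≤-trans (≤-pred (≰⇒> ℓ≱1)) z≤n)
  ... | yes 1≤ℓ = subst (_≤ N) (sym n≡ℓ) (≤-trans ℓ≤start (drop-nonempty R (proj₂ (rowStart ℓ 1≤ℓ ≤-refl))))
    where
      ℓ≤start : ℓ ≤ suc (pos ℓ)
      ℓ≤start = +-cancelˡ-≤ n ℓ (suc (pos ℓ)) (begin
        n + ℓ               ≡⟨ sym (rowStart-at ℓ 1≤ℓ ≤-refl) ⟩
        suc (pos ℓ + row ℓ) ≤⟨ s≤s (+-monoʳ-≤ (pos ℓ) (part-≤-first xs (proj₂ isP) ℓ)) ⟩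
        suc (pos ℓ + n)     ≡⟨ +-comm (suc (pos ℓ)) n ⟩
        n + suc (pos ℓ)     ∎)
        where open ≤-Reasoning

  Good : ℕ → Set
  Good s = s < n → ¬ p ∣ (n ∸ s + (n ∸ s) ∸ 1)

  -- At the first rim node (r , λ_r) of row r, at position s < n, the number
  -- 2(n − s) − 1 is the diagonal hook h_rr, which p does not divide.
  goodRowStart : ∀ r → 1 ≤ r → r ≤ ℓ → Good (pos r)
  goodRowStart r 1≤r r≤ℓ s<n p∣ = bg r 1≤r (≤-kk xs r 1≤r r≤ℓ r≤λr) (subst (p ∣_) hook≡ p∣)
    where
      s = pos r
      at = rowStart-at r 1≤r r≤ℓ
      r≤λr : r ≤ row r
      r≤λr = +-cancelˡ-≤ (suc s) r (row r) (≤-trans (+-monoˡ-≤ r s<n) (≤-reflexive (sym at)))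
      d = row r ∸ r
      λr≡ : row r ≡ r + d
      λr≡ = sym (m+[n∸m]≡n r≤λr)
      n∸s≡ : n ∸ s ≡ suc d
      n∸s≡ = trans (cong (_∸ s) (+-cancelʳ-≡ r n (s + suc d) (trans (sym at) (trans (cong (suc ∘ (s +_)) λr≡) (shift-arith s r d)))))
                   (m+n∸m≡n s (suc d))
      hook≡ : n ∸ s + (n ∸ s) ∸ 1 ≡ hook xs r r
      hook≡ = begin
        n ∸ s + (n ∸ s) ∸ 1                   ≡⟨ cong (λ m → m + m ∸ 1) n∸s≡ ⟩
        d + suc d                             ≡⟨ +-suc d d ⟩
        suc (d + d)                           ≡⟨ sym (m+n∸m≡n (r + r) (suc (d + d))) ⟩
        (r + r) + suc (d + d) ∸ (r + r)       ≡⟨ cong (_∸ (r + r)) (sym (hook-arith r d)) ⟩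
        (r + d + (r + d) + 1) ∸ (r + r)       ≡⟨ cong (λ m → (m + m + 1) ∸ (r + r)) (sym λr≡) ⟩
        (row r + row r + 1) ∸ (r + r)         ≡⟨ cong (λ m → (row r + m + 1) ∸ (r + r)) (sym (sc r 1≤r)) ⟩
        hook xs r r                           ∎
        where open ≡-Reasoning

  -- The rim starts at (1 , λ₁), so the first segment starts at a good position.
  good-0 : Good 0
  good-0 0<n = subst Good pos1≡0 (goodRowStart 1 ≤-refl 1≤ℓ) 0<n
    where
      1≤ℓ = subst (1 ≤_) n≡ℓ 0<n
      pos1≡0 : pos 1 ≡ 0
      pos1≡0 = +-cancelʳ-≡ n (pos 1) 0 (suc-injective (trans (rowStart-at 1 ≤-refl 1≤ℓ) (+-comm n 1)))

  seg : ℕ → List Node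
  seg s = take p (drop s R)

  seg-staircase : ∀ s → Staircase s (seg s)
  seg-staircase s = staircase-take p s (drop s R) (staircase-drop s 0 R rim-staircase)

  -- A segment ending before position n − 1 is complete, because the rim has at least n nodes.
  seg-full : ∀ s → s + length (seg s) < n → length (seg s) ≡ p
  seg-full s end<n with p ≤? length (drop s R)
  ... | yes p≤rest = trans (length-take p (drop s R)) (m≤n⇒m⊓n≡m p≤rest)
  ... | no  p≰rest = ⊥-elim (<⇒≱ end<n (begin
        n                        ≤⟨ n≤N ⟩
        N                        ≤⟨ m≤n+m∸n N s ⟩
        s + (N ∸ s)              ≡⟨ cong (s +_) (sym (length-drop s R)) ⟩
        s + length (drop s R)    ≡⟨ cong (s +_) (sym (m≥n⇒m⊓n≡n (<⇒≤ (≰⇒> p≰rest)))) ⟩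
        s + (p ⊓ length (drop s R)) ≡⟨ cong (s +_) (sym (length-take p (drop s R))) ⟩
        s + length (seg s)       ∎))
    where open ≤-Reasoning

  seg-before-next-row : ∀ s {i j} → last (seg s) ≡ just (i , j) → i < ℓ → s + length (seg s) ≤ pos (suc i)
  seg-before-next-row s {i} {j} e i<ℓ = +-cancelʳ-≤ j (s + length (seg s)) (pos (suc i)) (begin
    s + length (seg s) + j   ≡⟨ staircase-last s (seg s) (seg-staircase s) e ⟩
    n + i                    ≡⟨ suc-injective (trans (rowStart-at (suc i) (s≤s z≤n) i<ℓ) (+-suc n i)) ⟨
    pos (suc i) + row (suc i) ≤⟨ +-monoʳ-≤ (pos (suc i)) (All-last (seg s) (take⁺ p (drop⁺ s rim-columns)) e) ⟩
    pos (suc i) + j           ∎)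
    where open ≤-Reasoning

  -- One unfolding of the recursion defining Rim_p (Defs.segments): the segment
  -- at s is followed either by nothing, or by the segments from the first rim
  -- node t of the next row, which lies beyond the segment at a good position.
  data Step (f s : ℕ) : List Node → Set where
    halt : Step f s (seg s)
    jump : ∀ t → s + length (seg s) ≤ t → Good t → Step f s (seg s ++ segments p xs f (suc t))

  step : ∀ f s → Step f s (segments p xs (suc f) (suc s))
  step f s with last (segment p xs (suc s)) in e
  ... | nothing      = subst (Step f s) (last≡nothing⇒[] (seg s) e) halt
  ... | just (i , j) with i <ᵇ ℓ in i<ᵇℓ
  ...   | true  = jump (pos (suc i)) (seg-before-next-row s e i<ℓ) (goodRowStart (suc i) (s≤s z≤n) i<ℓ)
    where i<ℓ = <ᵇ⇒< i ℓ (subst T (sym i<ᵇℓ) _)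
  ...   | false = subst (Step f s) (sym (++-identityʳ (seg s))) halt

  segments-⊆ : ∀ f s → segments p xs f (suc s) ⊆ drop s R
  segments-⊆ zero    s = minimum _
  segments-⊆ (suc f) s with segments p xs (suc f) (suc s) | step f s
  ... | _ | halt         = take-⊆ p (drop s R)
  ... | _ | jump t end≤t _ =
    subst (seg s ++ segments p xs f (suc t) ⊆_) (take++drop-length p (drop s R))
      (++⁺ ⊆-refl (⊆-trans (segments-⊆ f t) (subst (drop t R ⊆_) (sym (drop-drop s _ R)) (drop⁺-≥ end≤t))))

  segments-below : ∀ f s → n ≤ s → filterᵇ isUpper (segments p xs f (suc s)) ≡ []
  segments-below zero    s _   = refl
  segments-below (suc f) s n≤s with segments p xs (suc f) (suc s) | step f s
  ... | _ | halt           = below-diagonal s (seg s) (seg-staircase s) n≤s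
  ... | _ | jump t end≤t _ = trans (filter-++ (T? ∘ isUpper) (seg s) _)
      (cong₂ _++_ (below-diagonal s (seg s) (seg-staircase s) n≤s)
                  (segments-below f t (≤-trans n≤s (≤-trans (m≤m+n s _) end≤t))))

  segment-then : ∀ s W → Good s → s < n →
    (n ≤ s + length (seg s) → filterᵇ isUpper W ≡ []) →
    (s + length (seg s) < n → UpperCount p (filterᵇ isUpper W)) →
    UpperCount p (filterᵇ isUpper (seg s ++ W))
  segment-then s W good s<n W-below W-count with s + length (seg s) <? n
  ... | yes end<n = subst (UpperCount p) (sym (trans split (cong (_++ _) (proj₁ above))))
                      (upperCount-++ p (seg s) _ (seg-full s end<n) (proj₂ above) (W-count end<n))
    where
      split = filter-++ (T? ∘ isUpper) (seg s) W
      above = above-diagonal s (seg s) (seg-staircase s) end<n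
  ... | no end≮n = subst (UpperCount p) (sym (trans split (trans (cong (_ ++_) (W-below n≤end)) (++-identityʳ _))))
                     (inj₂ (proj₂ crossing , subst (λ m → ¬ p ∣ (m + m ∸ 1)) (sym (proj₁ crossing)) (good s<n)))
    where
      split = filter-++ (T? ∘ isUpper) (seg s) W
      n≤end = ≮⇒≥ end≮n
      crossing = crosses-diagonal s (seg s) (seg-staircase s) s<n n≤end

  upperCount : ∀ f s → Good s → UpperCount p (filterᵇ isUpper (segments p xs f (suc s)))
  upperCount zero    s _    = upperCount-[] p
  upperCount (suc f) s good with n ≤? s
  ... | yes n≤s = subst (UpperCount p) (sym (segments-below (suc f) s n≤s)) (upperCount-[] p)
  ... | no  n≰s with segments p xs (suc f) (suc s) | step f s
  ...   | _ | halt = subst (UpperCount p ∘ filterᵇ isUpper) (++-identityʳ (seg s))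
                       (segment-then s [] good s<n (λ _ → refl) (λ _ → upperCount-[] p))
    where s<n = ≰⇒> n≰s
  ...   | _ | jump t end≤t good-t = segment-then s _ good s<n
                                      (λ n≤end → segments-below f t (≤-trans n≤end end≤t)) (λ _ → upperCount f t good-t)
    where s<n = ≰⇒> n≰s

  U : List Node
  U = Uλ p xs

  U-count : UpperCount p U
  U-count = upperCount N 0 good-0

  -- U lies on the rim, which has no repetitions.
  U-unique : Unique U
  U-unique = AllPairs-resp-⊆ (⊆-trans (filter-⊆ (T? ∘ isUpper) _) (segments-⊆ N 0)) (staircase-unique 0 R rim-staircase)

  aStar-count : aStar p xs + length (filterᵇ isDiagonal U) ≡ length U + length U
  aStar-count = mirror-count U U-unique (all-filter (T? ∘ isUpper) (rimP p xs))

lemma3p20 : (p : ℕ) → Prime p → ¬ (2 ∣ p) → (xs : List ℕ) → IsPartition xs → IsBG p xs →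
    (2 ∣ aStar p xs → p ∣ aStar p xs) × (p ∣ aStar p xs → 2 ∣ aStar p xs)
lemma3p20 p _ _ xs isP (sc , bg) = even⇔divisible p (aStar p xs) _ _ U-count aStar-count
  where open Segments p xs isP sc bg
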